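{- For all integers $m\ge 0$ and $n\ge 1$, $$\frac{1}{(A_1^{(n)})^2}\sum_{k=0}^m\binom{m}{k}T_{k}^{(s_{1,0}^{(n)},s_{1,1}^{(n)},s_{1,2}^{(n)})} T_{m-k}^{(s_{1,0}^{(n)},s_{1,1}^{(n)},s_{1,2}^{(n)})} =\frac{2^m}{A_1^{(2n)}}T_{m}^{(s_{1,0}^{(2n)},s_{1,1}^{(2n)},s_{1,2}^{(2n)})} +\frac{2}{A_2^{(n)}}\sum_{k=0}^m\binom{m}{k}(-1)^k T_{k}^{(s_{2,0}^{(n)},s_{2,1}^{(n)},s_{2,2}^{(n)})}.$$
   Context: Let $\alpha,\beta,\gamma$ be the three distinct complex roots of $x^3-x^2-x-1=0$, and set $c_1=\frac{\alpha}{(\alpha-\beta)(\alpha-\gamma)}$, $c_2=\frac{\beta}{(\beta-\alpha)(\beta-\gamma)}$, $c_3=\frac{\gamma}{(\gamma-\alpha)(\gamma-\beta)}$. For numbers $s_0,s_1,s_2$, the sequence $T_k^{(s_0,s_1,s_2)}$ is defined by $T_0^{(s_0,s_1,s_2)}=s_0$, $T_1^{(s_0,s_1,s_2)}=s_1$, $T_2^{(s_0,s_1,s_2)}=s_2$ and $T_k^{(s_0,s_1,s_2)}=T_{k-1}^{(s_0,s_1,s_2)}+T_{k-2}^{(s_0,s_1,s_2)}+T_{k-3}^{(s_0,s_1,s_2)}$ for $k\ge3$. For each integer $N\ge1$, let $A_1^{(N)}\neq0$ and $s_{1,0}^{(N)},s_{1,1}^{(N)},s_{1,2}^{(N)}$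 be numbers such that $c_1^Ne^{\alpha x}+c_2^Ne^{\beta x}+c_3^Ne^{\gamma x}=\frac{1}{A_1^{(N)}}\sum_{k\ge0}T_k^{(s_{1,0}^{(N)},s_{1,1}^{(N)},s_{1,2}^{(N)})}\frac{x^k}{k!}$, and let $A_2^{(N)}\neq0$ and $s_{2,0}^{(N)},s_{2,1}^{(N)},s_{2,2}^{(N)}$ be numbers such that $(c_2c_3)^Ne^{\alpha x}+(c_3c_1)^Ne^{\beta x}+(c_1c_2)^Ne^{\gamma x}=\frac{1}{A_2^{(N)}}\sum_{k\ge0}T_k^{(s_{2,0}^{(N)},s_{2,1}^{(N)},s_{2,2}^{(N)})}\frac{x^k}{k!}$ (in the paper these are specific integer normalizations). -}

module Defs where

open import Level using (Level; _⊔_) renaming (suc to lsuc)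
open import Data.Nat using (ℕ; zero; suc)
open import Data.Nat.Combinatorics using (_C_)
open import Data.Product using (_×_; _,_; proj₁)
open import Relation.Nullary using (¬_)
open import Algebra.Bundles using (CommutativeRing)

record Field (c ℓ : Level) : Set (lsuc (c ⊔ ℓ)) where
  field
    commutativeRing : CommutativeRing c ℓ
  open CommutativeRing commutativeRing public
  field
    _⁻¹      : Carrier → Carrier
    1≉0      : ¬ (1# ≈ 0#)
    ⁻¹-inverse : ∀ x → ¬ (x ≈ 0#) → x * (x ⁻¹) ≈ 1#

module FieldOps {c ℓ : Level} (F : Field c ℓ) where
  open Field F hiding (zero)

  _^_ : Carrier → ℕ → Carrier
  x ^ zero  = 1#
  x ^ suc n = x * (x ^ n)

  fromℕ : ℕ → Carrier
  fromℕ zero    = 0#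
  fromℕ (suc n) = 1# + fromℕ n

  sumTo : ℕ → (ℕ → Carrier) → Carrier
  sumTo zero    f = f zero
  sumTo (suc m) f = sumTo m f + f (suc m)

  binom : ℕ → ℕ → Carrier
  binom m k = fromℕ (m C k)

  -- the triple (T_k, T_{k+1}, T_{k+2}) of the tribonacci-type sequence
  private
    triple : Carrier → Carrier → Carrier → ℕ → Carrier × Carrier × Carrier
    triple s₀ s₁ s₂ zero = (s₀ , (s₁ , s₂))
    triple s₀ s₁ s₂ (suc k) with triple s₀ s₁ s₂ k
    ... | (a , (b , d)) = (b , (d , (d + b + a)))

  -- T_k^{(s₀,s₁,s₂)}: T_0 = s₀, T_1 = s₁, T_2 = s₂, T_k = T_{k-1} + T_{k-2} + T_{k-3}
  T : Carrier → Carrier → Carrier → ℕ → Carrier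
  T s₀ s₁ s₂ k = proj₁ (triple s₀ s₁ s₂ k)

  cubic : Carrier → Carrier
  cubic x = x * x * x - x * x - x - 1#

-- Setup attached to three elements α β γ (intended: the three distinct roots of the cubic).
module Setup {c ℓ : Level} (F : Field c ℓ) (α β γ : Field.Carrier F) where
  open Field F hiding (zero)
  open FieldOps F

  c₁ c₂ c₃ : Carrier
  c₁ = α * (((α - β) * (α - γ)) ⁻¹)
  c₂ = β * (((β - α) * (β - γ)) ⁻¹)
  c₃ = γ * (((γ - α) * (γ - β)) ⁻¹)

  -- k-th coefficient (w.r.t. x^k/k!) of c₁^N e^{αx} + c₂^N e^{βx} + c₃^N e^{γx}
  egf₁ : ℕ → ℕ → Carrier
  egf₁ N k = (c₁ ^ N) * (α ^ k) + (c₂ ^ N) * (β ^ k) + (c₃ ^ N) * (γ ^ k)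

  -- k-th coefficient (w.r.t. x^k/k!) of (c₂c₃)^N e^{αx} + (c₃c₁)^N e^{βx} + (c₁c₂)^N e^{γx}
  egf₂ : ℕ → ℕ → Carrier
  egf₂ N k = ((c₂ * c₃) ^ N) * (α ^ k) + ((c₃ * c₁) ^ N) * (β ^ k) + ((c₁ * c₂) ^ N) * (γ ^ k)

  -- A ≠ 0 and  c₁^N e^{αx}+c₂^N e^{βx}+c₃^N e^{γx} = (1/A) Σ_k T_k^{(s₀,s₁,s₂)} x^k/k!
  -- (equality of exponential generating functions, coefficientwise)
  IsNorm₁ : ℕ → Carrier → Carrier → Carrier → Carrier → Set ℓ
  IsNorm₁ N A s₀ s₁ s₂ = ¬ (A ≈ 0#) × (∀ k → egf₁ N k ≈ (A ⁻¹) * T s₀ s₁ s₂ k)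

  IsNorm₂ : ℕ → Carrier → Carrier → Carrier → Carrier → Set ℓ
  IsNorm₂ N A s₀ s₁ s₂ = ¬ (A ≈ 0#) × (∀ k → egf₂ N k ≈ (A ⁻¹) * T s₀ s₁ s₂ k)

{-# OPTIONS --safe #-}
-- Write u, v, w for c₁ⁿ, c₂ⁿ, c₃ⁿ and r₁, r₂, r₃ for α, β, γ. Once the normalisations
-- A are cleared, the left-hand side is the coefficient of x^m/m! in
-- (u e^{αx} + v e^{βx} + w e^{γx})² = Σ_{i,j} u_i u_j e^{(r_i + r_j)x}. The diagonal
-- terms give 2^m times the coefficient for the weights c_i^{2n} = u_i². Distinct roots
-- of x³ - x² - x - 1 sum to 1, so off the diagonal r_i + r_j = 1 - r_l, and the
-- coefficient of e^{(1 - r_l)x} is an alternating binomial sum of powers of r_l; with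
-- u_i u_j = (c_i c_j)ⁿ the off-diagonal pairs, each counted twice, give the last sum.
-- Nothing else about the c_i is used: the identity holds for arbitrary weights.
module Submission where

open import Defs
open import Level using (Level)
open import Data.Nat using (ℕ; _≤_; _∸_) renaming (_*_ to _*ℕ_)
open import Relation.Nullary using (¬_)

open import Algebra.Bundles using (CommutativeRing)
open import Algebra.Solver.Ring.AlmostCommutativeRing
  using (fromCommutativeRing; _-Raw-AlmostCommutative⟶_)
open import Data.Fin using (toℕ)
open import Data.Integer as ℤ using (ℤ; +_; -[1+_]; _⊖_; sign; ∣_∣; _◃_)
import Data.Integer.Properties as ℤ
open import Data.Maybe using (map)
open import Data.Nat as ℕ using (zero; suc; z≤n)
import Data.Nat.Properties as ℕ
open import Data.Nat.Combinatorics using (_C_)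
open import Data.Product using (_,_)
open import Data.Sign as Sign using (Sign)
open import Function using (_∘_)
open import Relation.Nullary.Decidable using (dec⇒maybe)
open import Relation.Binary.PropositionalEquality using (cong)

-- The ring solver of the library needs a coefficient ring with decidable equality;
-- ℤ maps into every commutative ring.
module IntegerCoefficients {c ℓ} (R : CommutativeRing c ℓ) where
  open CommutativeRing R
  open import Algebra.Properties.Semiring.Mult.TCOptimised semiring using (_×_; 1+×; ×-homo-+; ×1-homo-*)
  open import Algebra.Properties.Ring ring using (-1*x≈-x)
  open import Algebra.Properties.AbelianGroup +-abelianGroup using (⁻¹-∙-comm)
  open import Algebra.Properties.Group +-group using (ε⁻¹≈ε; ⁻¹-involutive)
  open import Algebra.Properties.CommutativeSemigroup *-commutativeSemigroup using (interchange)
  open import Relation.Binary.Reasoning.Setoid setoid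

  -- The optimised _×_ makes ⟦ + 1 ⟧ℤ reduce to 1#, so that con (+ 1) in a solved
  -- equation matches 1# in a goal definitionally.
  ⟦_⟧ℤ : ℤ → Carrier
  ⟦ + n      ⟧ℤ = n × 1#
  ⟦ -[1+ n ] ⟧ℤ = - (suc n × 1#)

  x-0≈x : ∀ x → x - 0# ≈ x
  x-0≈x x = trans (+-congˡ ε⁻¹≈ε) (+-identityʳ x)

  [1+x]-[1+y]≈x-y : ∀ x y → (1# + x) - (1# + y) ≈ x - y
  [1+x]-[1+y]≈x-y x y = begin
    (1# + x) - (1# + y)   ≈⟨ +-cong (+-comm x 1#) (⁻¹-∙-comm 1# y) ⟨
    (x + 1#) + (- 1# - y) ≈⟨ +-assoc x 1# _ ⟩
    x + (1# + (- 1# - y)) ≈⟨ +-congˡ (+-assoc 1# (- 1#) (- y)) ⟨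
    x + ((1# - 1#) - y)   ≈⟨ +-congˡ (+-congʳ (-‿inverseʳ 1#)) ⟩
    x + (0# - y)          ≈⟨ +-congˡ (+-identityˡ (- y)) ⟩
    x - y                 ∎

  ⊖-homo : ∀ m n → ⟦ m ⊖ n ⟧ℤ ≈ m × 1# - n × 1#
  ⊖-homo zero    zero    = sym (x-0≈x 0#)
  ⊖-homo zero    (suc n) = sym (+-identityˡ _)
  ⊖-homo (suc m) zero    = sym (x-0≈x _)
  ⊖-homo (suc m) (suc n) = begin
    ⟦ suc m ⊖ suc n ⟧ℤ                ≡⟨ cong ⟦_⟧ℤ (ℤ.[1+m]⊖[1+n]≡m⊖n m n) ⟩
    ⟦ m ⊖ n ⟧ℤ                        ≈⟨ ⊖-homo m n ⟩
    m × 1# - n × 1#                   ≈⟨ [1+x]-[1+y]≈x-y _ _ ⟨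
    (1# + m × 1#) - (1# + n × 1#)     ≈⟨ +-cong (1+× m 1#) (-‿cong (1+× n 1#)) ⟨
    suc m × 1# - suc n × 1#           ∎

  +-homo : ∀ i j → ⟦ i ℤ.+ j ⟧ℤ ≈ ⟦ i ⟧ℤ + ⟦ j ⟧ℤ
  +-homo (+ m)      (+ n)      = ×-homo-+ 1# m n
  +-homo (+ m)      -[1+ n ]   = ⊖-homo m (suc n)
  +-homo -[1+ m ]   (+ n)      = trans (⊖-homo n (suc m)) (+-comm _ _)
  +-homo -[1+ m ]   -[1+ n ]   = begin
    - (suc (suc (m ℕ.+ n)) × 1#)      ≡⟨ cong (λ k → - (suc k × 1#)) (ℕ.+-suc m n) ⟨
    - ((suc m ℕ.+ suc n) × 1#)        ≈⟨ -‿cong (×-homo-+ 1# (suc m) (suc n)) ⟩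
    - (suc m × 1# + suc n × 1#)       ≈⟨ ⁻¹-∙-comm _ _ ⟨
    - (suc m × 1#) - (suc n × 1#)     ∎

  -‿homo : ∀ i → ⟦ ℤ.- i ⟧ℤ ≈ - ⟦ i ⟧ℤ
  -‿homo (+ zero)  = sym ε⁻¹≈ε
  -‿homo (+ suc n) = refl
  -‿homo -[1+ n ]  = sym (⁻¹-involutive _)

  ⟦_⟧ₛ : Sign → Carrier
  ⟦ Sign.+ ⟧ₛ = 1#
  ⟦ Sign.- ⟧ₛ = - 1#

  ◃-homo : ∀ s n → ⟦ s ◃ n ⟧ℤ ≈ ⟦ s ⟧ₛ * (n × 1#)
  ◃-homo s        zero    = sym (zeroʳ _)
  ◃-homo Sign.+   (suc n) = sym (*-identityˡ _)
  ◃-homo Sign.-   (suc n) = sym (-1*x≈-x _)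

  sign-abs : ∀ i → ⟦ i ⟧ℤ ≈ ⟦ sign i ⟧ₛ * (∣ i ∣ × 1#)
  sign-abs (+ n)    = sym (*-identityˡ _)
  sign-abs -[1+ n ] = sym (-1*x≈-x _)

  sign-*-homo : ∀ s t → ⟦ s Sign.* t ⟧ₛ ≈ ⟦ s ⟧ₛ * ⟦ t ⟧ₛ
  sign-*-homo Sign.+ t      = sym (*-identityˡ _)
  sign-*-homo Sign.- Sign.+ = sym (*-identityʳ _)
  sign-*-homo Sign.- Sign.- = sym (trans (-1*x≈-x _) (⁻¹-involutive _))

  *-homo : ∀ i j → ⟦ i ℤ.* j ⟧ℤ ≈ ⟦ i ⟧ℤ * ⟦ j ⟧ℤ
  *-homo i j = begin
    ⟦ (sign i Sign.* sign j) ◃ (∣ i ∣ ℕ.* ∣ j ∣) ⟧ℤ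
      ≈⟨ ◃-homo (sign i Sign.* sign j) (∣ i ∣ ℕ.* ∣ j ∣) ⟩
    ⟦ sign i Sign.* sign j ⟧ₛ * ((∣ i ∣ ℕ.* ∣ j ∣) × 1#)
      ≈⟨ *-cong (sign-*-homo (sign i) (sign j)) (×1-homo-* ∣ i ∣ ∣ j ∣) ⟩
    (⟦ sign i ⟧ₛ * ⟦ sign j ⟧ₛ) * ((∣ i ∣ × 1#) * (∣ j ∣ × 1#))
      ≈⟨ interchange _ _ _ _ ⟩
    (⟦ sign i ⟧ₛ * (∣ i ∣ × 1#)) * (⟦ sign j ⟧ₛ * (∣ j ∣ × 1#))
      ≈⟨ *-cong (sign-abs i) (sign-abs j) ⟨
    ⟦ i ⟧ℤ * ⟦ j ⟧ℤ
      ∎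

  ℤ-homomorphism : ℤ.+-*-rawRing -Raw-AlmostCommutative⟶ fromCommutativeRing R
  ℤ-homomorphism = record
    { ⟦_⟧ = ⟦_⟧ℤ ; +-homo = +-homo ; *-homo = *-homo ; -‿homo = -‿homo
    ; 0-homo = refl ; 1-homo = refl }

  open import Algebra.Solver.Ring ℤ.+-*-rawRing (fromCommutativeRing R) ℤ-homomorphism
    (λ i j → map (reflexive ∘ cong ⟦_⟧ℤ) (dec⇒maybe (i ℤ.≟ j))) public

module BinomialConvolution {c ℓ : Level} (F : Field c ℓ) where
  open Field F hiding (zero)
  open FieldOps F
  open IntegerCoefficients commutativeRing using (solve; _:=_; _:+_; _:*_; _:-_; con)
  open import Algebra.Properties.Group +-group using (x∙y⁻¹≈ε⇒x≈y)
  open import Algebra.Properties.Ring ring using (-1*x≈-x)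
  open import Algebra.Properties.Semiring.Mult semiring using (_×_; ×-congʳ)
  open import Algebra.Properties.Monoid.Sum +-monoid using (sum)
  import Algebra.Properties.Semiring.Exp semiring as Exp
  import Algebra.Properties.CommutativeSemiring.Binomial commutativeSemiring as Binomial
  open import Relation.Binary.Reasoning.Setoid setoid

  ⁻¹-cancelˡ : ∀ {x} y → x ≉ 0# → x ⁻¹ * (x * y) ≈ y
  ⁻¹-cancelˡ {x} y x≉0 = begin
    x ⁻¹ * (x * y)  ≈⟨ *-assoc _ _ _ ⟨
    (x ⁻¹ * x) * y  ≈⟨ *-congʳ (trans (*-comm _ _) (⁻¹-inverse x x≉0)) ⟩
    1# * y          ≈⟨ *-identityˡ y ⟩
    y               ∎

  x≉0∧x*y≈0⇒y≈0 : ∀ {x y} → x ≉ 0# → x * y ≈ 0# → y ≈ 0#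
  x≉0∧x*y≈0⇒y≈0 {x} {y} x≉0 x*y≈0 = begin
    y               ≈⟨ ⁻¹-cancelˡ y x≉0 ⟨
    x ⁻¹ * (x * y)  ≈⟨ *-congˡ x*y≈0 ⟩
    x ⁻¹ * 0#       ≈⟨ zeroʳ _ ⟩
    0#              ∎

  x*y≉0 : ∀ {x y} → x ≉ 0# → y ≉ 0# → x * y ≉ 0#
  x*y≉0 x≉0 y≉0 x*y≈0 = y≉0 (x≉0∧x*y≈0⇒y≈0 x≉0 x*y≈0)

  x≉y∧[x-y]*z≈0⇒z≈0 : ∀ {x y z} → x ≉ y → (x - y) * z ≈ 0# → z ≈ 0#
  x≉y∧[x-y]*z≈0⇒z≈0 x≉y = x≉0∧x*y≈0⇒y≈0 (λ x-y≈0 → x≉y (x∙y⁻¹≈ε⇒x≈y _ _ x-y≈0))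

  x≈a⁻¹*y⇒y≈a*x : ∀ {a x y} → a ≉ 0# → x ≈ a ⁻¹ * y → y ≈ a * x
  x≈a⁻¹*y⇒y≈a*x {a} {x} {y} a≉0 x≈a⁻¹*y = begin
    y               ≈⟨ *-identityˡ y ⟨
    1# * y          ≈⟨ *-congʳ (⁻¹-inverse a a≉0) ⟨
    (a * a ⁻¹) * y  ≈⟨ *-assoc _ _ _ ⟩
    a * (a ⁻¹ * y)  ≈⟨ *-congˡ x≈a⁻¹*y ⟨
    a * x           ∎

  sumTo-cong : ∀ m {f g : ℕ → Carrier} → (∀ k → k ≤ m → f k ≈ g k) → sumTo m f ≈ sumTo m g
  sumTo-cong zero    f≈g = f≈g 0 z≤n
  sumTo-cong (suc m) f≈g = +-cong (sumTo-cong m (λ k k≤m → f≈g k (ℕ.m≤n⇒m≤1+n k≤m))) (f≈g (suc m) ℕ.≤-refl)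

  sumTo-distrib-+ : ∀ m (f g : ℕ → Carrier) → sumTo m (λ k → f k + g k) ≈ sumTo m f + sumTo m g
  sumTo-distrib-+ zero    f g = refl
  sumTo-distrib-+ (suc m) f g = trans (+-congʳ (sumTo-distrib-+ m f g))
    (solve 4 (λ a b c d → (a :+ b) :+ (c :+ d) := (a :+ c) :+ (b :+ d)) refl _ _ _ _)

  *-distribˡ-sumTo : ∀ m a (f : ℕ → Carrier) → a * sumTo m f ≈ sumTo m (λ k → a * f k)
  *-distribˡ-sumTo zero    a f = refl
  *-distribˡ-sumTo (suc m) a f = trans (distribˡ a _ _) (+-congʳ (*-distribˡ-sumTo m a f))

  sumTo-linear₃ : ∀ m u v w (f g h : ℕ → Carrier) →
    sumTo m (λ k → u * f k + v * g k + w * h k) ≈ u * sumTo m f + v * sumTo m g + w * sumTo m h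
  sumTo-linear₃ m u v w f g h = begin
    sumTo m (λ k → u * f k + v * g k + w * h k)
      ≈⟨ trans (sumTo-distrib-+ m _ _) (+-congʳ (sumTo-distrib-+ m _ _)) ⟩
    sumTo m (λ k → u * f k) + sumTo m (λ k → v * g k) + sumTo m (λ k → w * h k)
      ≈⟨ +-cong (+-cong (*-distribˡ-sumTo m u f) (*-distribˡ-sumTo m v g)) (*-distribˡ-sumTo m w h) ⟨
    u * sumTo m f + v * sumTo m g + w * sumTo m h
      ∎

  inverse-*-sumTo : ∀ {A} {f g : ℕ → Carrier} (h : ℕ → Carrier) → (∀ k → f k ≈ A ⁻¹ * g k) →
                    ∀ m → A ⁻¹ * sumTo m (λ k → h k * g k) ≈ sumTo m (λ k → h k * f k)
  inverse-*-sumTo {A} {f} {g} h f≈A⁻¹g m = trans (*-distribˡ-sumTo m (A ⁻¹) _) (sumTo-cong m (λ k _ → begin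
    A ⁻¹ * (h k * g k)  ≈⟨ solve 3 (λ a h g → a :* (h :* g) := h :* (a :* g)) refl (A ⁻¹) (h k) (g k) ⟩
    h k * (A ⁻¹ * g k)  ≈⟨ *-congˡ (f≈A⁻¹g k) ⟨
    h k * f k           ∎))

  sumTo-suc : ∀ m (f : ℕ → Carrier) → sumTo (suc m) f ≈ f 0 + sumTo m (λ k → f (suc k))
  sumTo-suc zero    f = refl
  sumTo-suc (suc m) f = trans (+-congʳ (sumTo-suc m f)) (+-assoc _ _ _)

  sumTo≈sum : ∀ m (f : ℕ → Carrier) → sumTo m f ≈ sum {suc m} (λ k → f (toℕ k))
  sumTo≈sum zero    f = sym (+-identityʳ (f 0))
  sumTo≈sum (suc m) f = trans (sumTo-suc m f) (+-congˡ (sumTo≈sum m (λ k → f (suc k))))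

  combination-cong : ∀ u v w {p p' q q' r r'} → p ≈ p' → q ≈ q' → r ≈ r' →
    u * p + v * q + w * r ≈ u * p' + v * q' + w * r'
  combination-cong u v w p≈p' q≈q' r≈r' = +-cong (+-cong (*-congˡ p≈p') (*-congˡ q≈q')) (*-congˡ r≈r')

  ^-congˡ : ∀ m {x y} → x ≈ y → x ^ m ≈ y ^ m
  ^-congˡ zero    x≈y = refl
  ^-congˡ (suc m) x≈y = *-cong x≈y (^-congˡ m x≈y)

  ^-distrib-* : ∀ m x y → (x * y) ^ m ≈ x ^ m * y ^ m
  ^-distrib-* zero    x y = sym (*-identityˡ 1#)
  ^-distrib-* (suc m) x y = trans (*-congˡ (^-distrib-* m x y))
    (solve 4 (λ x y xᵐ yᵐ → (x :* y) :* (xᵐ :* yᵐ) := (x :* xᵐ) :* (y :* yᵐ)) refl x y (x ^ m) (y ^ m))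

  1^m≈1 : ∀ m → 1# ^ m ≈ 1#
  1^m≈1 zero    = refl
  1^m≈1 (suc m) = trans (*-identityˡ _) (1^m≈1 m)

  ^-homo-* : ∀ x m n → x ^ (m ℕ.+ n) ≈ x ^ m * x ^ n
  ^-homo-* x zero    n = sym (*-identityˡ _)
  ^-homo-* x (suc m) n = trans (*-congˡ (^-homo-* x m n)) (sym (*-assoc _ _ _))

  ^[2*n]≈^n*^n : ∀ n x → x ^ (2 *ℕ n) ≈ x ^ n * x ^ n
  ^[2*n]≈^n*^n n x = trans (^-homo-* x n (n ℕ.+ 0)) (*-congˡ (reflexive (cong (x ^_) (ℕ.+-identityʳ n))))

  ^≈Exp^ : ∀ x n → x ^ n ≈ x Exp.^ n
  ^≈Exp^ x zero    = refl
  ^≈Exp^ x (suc n) = *-congˡ (^≈Exp^ x n)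

  fromℕ*≈× : ∀ n x → fromℕ n * x ≈ n × x
  fromℕ*≈× zero    x = zeroˡ x
  fromℕ*≈× (suc n) x = trans (distribʳ x 1# (fromℕ n)) (+-cong (*-identityˡ x) (fromℕ*≈× n x))

  -- (f ⋆ g) m is the coefficient of x^m/m! in the product of the exponential
  -- generating functions of f and g.
  infixl 7 _⋆_
  _⋆_ : (ℕ → Carrier) → (ℕ → Carrier) → ℕ → Carrier
  (f ⋆ g) m = sumTo m (λ k → binom m k * f k * g (m ∸ k))

  binomial-theorem : ∀ m a b → ((a ^_) ⋆ (b ^_)) m ≈ (a + b) ^ m
  binomial-theorem m a b = begin
    ((a ^_) ⋆ (b ^_)) m
      ≈⟨ sumTo-cong m (λ k _ → trans (*-assoc _ _ _) (trans (fromℕ*≈× (m C k) _)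
           (×-congʳ (m C k) (*-cong (^≈Exp^ a k) (^≈Exp^ b (m ∸ k)))))) ⟩
    sumTo m (λ k → (m C k) × (a Exp.^ k * b Exp.^ (m ∸ k)))
      ≈⟨ sumTo≈sum m _ ⟩
    Binomial.binomialExpansion a b m
      ≈⟨ Binomial.theorem m a b ⟨
    (a + b) Exp.^ m
      ≈⟨ ^≈Exp^ (a + b) m ⟨
    (a + b) ^ m
      ∎

  alternating-binomial : ∀ m x → sumTo m (λ k → binom m k * (- 1#) ^ k * x ^ k) ≈ (1# - x) ^ m
  alternating-binomial m x = begin
    sumTo m (λ k → binom m k * (- 1#) ^ k * x ^ k)  ≈⟨ sumTo-cong m (λ k _ → summand k) ⟩
    (((- x) ^_) ⋆ (1# ^_)) m                        ≈⟨ binomial-theorem m (- x) 1# ⟩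
    (- x + 1#) ^ m                                  ≈⟨ ^-congˡ m (+-comm (- x) 1#) ⟩
    (1# - x) ^ m                                    ∎
    where
    summand : ∀ k → binom m k * (- 1#) ^ k * x ^ k ≈ binom m k * (- x) ^ k * 1# ^ (m ∸ k)
    summand k = begin
      binom m k * (- 1#) ^ k * x ^ k          ≈⟨ trans (*-identityʳ _) (sym (*-assoc _ _ _)) ⟨
      binom m k * ((- 1#) ^ k * x ^ k) * 1#   ≈⟨ *-cong (*-congˡ (^-distrib-* k (- 1#) x)) (1^m≈1 (m ∸ k)) ⟨
      binom m k * (- 1# * x) ^ k * 1# ^ (m ∸ k) ≈⟨ *-congʳ (*-congˡ (^-congˡ k (-1*x≈-x x))) ⟩
      binom m k * (- x) ^ k * 1# ^ (m ∸ k)    ∎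

  ⋆-cong : ∀ {f f' g g' : ℕ → Carrier} → (∀ k → f k ≈ f' k) → (∀ k → g k ≈ g' k) →
           ∀ m → (f ⋆ g) m ≈ (f' ⋆ g') m
  ⋆-cong f≈f' g≈g' m = sumTo-cong m (λ k _ → *-cong (*-congˡ (f≈f' k)) (g≈g' (m ∸ k)))

  ⋆-scale : ∀ a b (f g : ℕ → Carrier) m → ((λ k → a * f k) ⋆ (λ k → b * g k)) m ≈ (a * b) * (f ⋆ g) m
  ⋆-scale a b f g m = begin
    ((λ k → a * f k) ⋆ (λ k → b * g k)) m
      ≈⟨ sumTo-cong m (λ k _ → solve 5 (λ B a b x y → B :* (a :* x) :* (b :* y) := (a :* b) :* (B :* x :* y))
           refl (binom m k) a b (f k) (g (m ∸ k))) ⟩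
    sumTo m (λ k → (a * b) * (binom m k * f k * g (m ∸ k)))
      ≈⟨ *-distribˡ-sumTo m (a * b) _ ⟨
    (a * b) * (f ⋆ g) m
      ∎

  inverse-square-⋆ : ∀ {A} {f g : ℕ → Carrier} → A ≉ 0# → (∀ k → f k ≈ A ⁻¹ * g k) →
                     ∀ m → (A * A) ⁻¹ * (g ⋆ g) m ≈ (f ⋆ f) m
  inverse-square-⋆ {A} {f} {g} A≉0 f≈A⁻¹g m = begin
    (A * A) ⁻¹ * (g ⋆ g) m                          ≈⟨ *-congˡ (⋆-cong g≈Af g≈Af m) ⟩
    (A * A) ⁻¹ * ((λ k → A * f k) ⋆ (λ k → A * f k)) m ≈⟨ *-congˡ (⋆-scale A A f f m) ⟩
    (A * A) ⁻¹ * ((A * A) * (f ⋆ f) m)              ≈⟨ ⁻¹-cancelˡ _ (x*y≉0 A≉0 A≉0) ⟩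
    (f ⋆ f) m                                       ∎
    where
    g≈Af : ∀ k → g k ≈ A * f k
    g≈Af k = x≈a⁻¹*y⇒y≈a*x A≉0 (f≈A⁻¹g k)

  -- egf₁ N and egf₂ N of Setup are, definitionally, instances of expSum.
  expSum : Carrier → Carrier → Carrier → Carrier → Carrier → Carrier → ℕ → Carrier
  expSum u v w a b d k = u * a ^ k + v * b ^ k + w * d ^ k

  expSum-cong : ∀ {u u' v v' w w'} a b d k → u ≈ u' → v ≈ v' → w ≈ w' →
                expSum u v w a b d k ≈ expSum u' v' w' a b d k
  expSum-cong a b d k u≈u' v≈v' w≈w' = +-cong (+-cong (*-congʳ u≈u') (*-congʳ v≈v')) (*-congʳ w≈w')

  expSum-⋆ : ∀ u v w a b d (g : ℕ → Carrier) m →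
    (expSum u v w a b d ⋆ g) m ≈ u * ((a ^_) ⋆ g) m + v * ((b ^_) ⋆ g) m + w * ((d ^_) ⋆ g) m
  expSum-⋆ u v w a b d g m = trans
    (sumTo-cong m (λ k _ → solve 8 (λ B u v w aᵏ bᵏ dᵏ y →
       B :* (u :* aᵏ :+ v :* bᵏ :+ w :* dᵏ) :* y := u :* (B :* aᵏ :* y) :+ v :* (B :* bᵏ :* y) :+ w :* (B :* dᵏ :* y))
       refl (binom m k) u v w (a ^ k) (b ^ k) (d ^ k) (g (m ∸ k))))
    (sumTo-linear₃ m u v w _ _ _)

  ^-⋆-expSum : ∀ x u v w a b d m → ((x ^_) ⋆ expSum u v w a b d) m ≈ expSum u v w (x + a) (x + b) (x + d) m
  ^-⋆-expSum x u v w a b d m = begin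
    ((x ^_) ⋆ expSum u v w a b d) m
      ≈⟨ sumTo-cong m (λ k _ → solve 8 (λ B xᵏ u v w a b d →
           B :* xᵏ :* (u :* a :+ v :* b :+ w :* d) := u :* (B :* xᵏ :* a) :+ v :* (B :* xᵏ :* b) :+ w :* (B :* xᵏ :* d))
           refl (binom m k) (x ^ k) u v w (a ^ (m ∸ k)) (b ^ (m ∸ k)) (d ^ (m ∸ k))) ⟩
    sumTo m (λ k → u * (binom m k * x ^ k * a ^ (m ∸ k)) + v * (binom m k * x ^ k * b ^ (m ∸ k))
                   + w * (binom m k * x ^ k * d ^ (m ∸ k)))
      ≈⟨ sumTo-linear₃ m u v w _ _ _ ⟩
    u * ((x ^_) ⋆ (a ^_)) m + v * ((x ^_) ⋆ (b ^_)) m + w * ((x ^_) ⋆ (d ^_)) m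
      ≈⟨ combination-cong u v w (binomial-theorem m x a) (binomial-theorem m x b) (binomial-theorem m x d) ⟩
    expSum u v w (x + a) (x + b) (x + d) m
      ∎

  alternating-expSum : ∀ m u v w a b d →
    sumTo m (λ k → binom m k * (- 1#) ^ k * expSum u v w a b d k) ≈ u * (1# - a) ^ m + v * (1# - b) ^ m + w * (1# - d) ^ m
  alternating-expSum m u v w a b d = begin
    sumTo m (λ k → binom m k * (- 1#) ^ k * expSum u v w a b d k)
      ≈⟨ sumTo-cong m (λ k _ → solve 8 (λ B s u v w a b d →
           B :* s :* (u :* a :+ v :* b :+ w :* d) := u :* (B :* s :* a) :+ v :* (B :* s :* b) :+ w :* (B :* s :* d))
           refl (binom m k) ((- 1#) ^ k) u v w (a ^ k) (b ^ k) (d ^ k)) ⟩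
    sumTo m (λ k → u * (binom m k * (- 1#) ^ k * a ^ k) + v * (binom m k * (- 1#) ^ k * b ^ k)
                   + w * (binom m k * (- 1#) ^ k * d ^ k))
      ≈⟨ sumTo-linear₃ m u v w _ _ _ ⟩
    u * sumTo m (λ k → binom m k * (- 1#) ^ k * a ^ k) + v * sumTo m (λ k → binom m k * (- 1#) ^ k * b ^ k)
      + w * sumTo m (λ k → binom m k * (- 1#) ^ k * d ^ k)
      ≈⟨ combination-cong u v w (alternating-binomial m a) (alternating-binomial m b) (alternating-binomial m d) ⟩
    u * (1# - a) ^ m + v * (1# - b) ^ m + w * (1# - d) ^ m
      ∎

  cubic-roots-quadratic : ∀ {x y} → x ≉ y → cubic x ≈ 0# → cubic y ≈ 0# →
                          x * x + x * y + y * y - x - y - 1# ≈ 0#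
  cubic-roots-quadratic {x} {y} x≉y cubic-x cubic-y = x≉y∧[x-y]*z≈0⇒z≈0 x≉y (begin
    (x - y) * (x * x + x * y + y * y - x - y - 1#)
      ≈⟨ solve 2 (λ x y → (x :- y) :* (x :* x :+ x :* y :+ y :* y :- x :- y :- con (ℤ.+ 1))
                        := (x :* x :* x :- x :* x :- x :- con (ℤ.+ 1)) :- (y :* y :* y :- y :* y :- y :- con (ℤ.+ 1)))
           refl x y ⟩
    cubic x - cubic y  ≈⟨ +-cong cubic-x (-‿cong cubic-y) ⟩
    0# - 0#            ≈⟨ -‿inverseʳ 0# ⟩
    0#                 ∎)

  cubic-roots-sum : ∀ {α β γ} → α ≉ β → β ≉ γ → α ≉ γ →
                    cubic α ≈ 0# → cubic β ≈ 0# → cubic γ ≈ 0# → α + β + γ ≈ 1#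
  cubic-roots-sum {α} {β} {γ} α≉β β≉γ α≉γ cubic-α cubic-β cubic-γ =
    x∙y⁻¹≈ε⇒x≈y _ _ (x≉y∧[x-y]*z≈0⇒z≈0 β≉γ (begin
      (β - γ) * (α + β + γ - 1#)
        ≈⟨ solve 3 (λ a b g → (b :- g) :* (a :+ b :+ g :- con (ℤ.+ 1))
                   := (a :* a :+ a :* b :+ b :* b :- a :- b :- con (ℤ.+ 1)) :- (a :* a :+ a :* g :+ g :* g :- a :- g :- con (ℤ.+ 1)))
             refl α β γ ⟩
      _ - _   ≈⟨ +-cong (cubic-roots-quadratic α≉β cubic-α cubic-β) (-‿cong (cubic-roots-quadratic α≉γ cubic-α cubic-γ)) ⟩
      0# - 0# ≈⟨ -‿inverseʳ 0# ⟩
      0#      ∎))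

  expSum-⋆-self : ∀ {α β γ} → α + β + γ ≈ 1# → ∀ u v w m →
    (expSum u v w α β γ ⋆ expSum u v w α β γ) m
      ≈ (1# + 1#) ^ m * expSum (u * u) (v * v) (w * w) α β γ m
        + (1# + 1#) * sumTo m (λ k → binom m k * (- 1#) ^ k * expSum (v * w) (w * u) (u * v) α β γ k)
  expSum-⋆-self {α} {β} {γ} α+β+γ≈1 u v w m = begin
    (E ⋆ E) m
      ≈⟨ expSum-⋆ u v w α β γ E m ⟩
    u * ((α ^_) ⋆ E) m + v * ((β ^_) ⋆ E) m + w * ((γ ^_) ⋆ E) m
      ≈⟨ combination-cong u v w (^-⋆-expSum α u v w α β γ m) (^-⋆-expSum β u v w α β γ m) (^-⋆-expSum γ u v w α β γ m) ⟩
    u * expSum u v w (α + α) (α + β) (α + γ) m + v * expSum u v w (β + α) (β + β) (β + γ) m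
      + w * expSum u v w (γ + α) (γ + β) (γ + γ) m
      ≈⟨ combination-cong u v w
           (combination-cong u v w (double α) (^-congˡ m αβ) (^-congˡ m αγ))
           (combination-cong u v w (^-congˡ m (trans (+-comm β α) αβ)) (double β) (^-congˡ m βγ))
           (combination-cong u v w (^-congˡ m (trans (+-comm γ α) αγ)) (^-congˡ m (trans (+-comm γ β) βγ)) (double γ)) ⟩
    u * (u * (P * α ^ m) + v * Dγ + w * Dβ) + v * (u * Dγ + v * (P * β ^ m) + w * Dα)
      + w * (u * Dβ + v * Dα + w * (P * γ ^ m))
      ≈⟨ solve 10 (λ u v w P aᵐ bᵐ gᵐ Da Db Dg →
           u :* (u :* (P :* aᵐ) :+ v :* Dg :+ w :* Db) :+ v :* (u :* Dg :+ v :* (P :* bᵐ) :+ w :* Da)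
             :+ w :* (u :* Db :+ v :* Da :+ w :* (P :* gᵐ))
           := P :* (u :* u :* aᵐ :+ v :* v :* bᵐ :+ w :* w :* gᵐ)
             :+ (con (ℤ.+ 1) :+ con (ℤ.+ 1)) :* (v :* w :* Da :+ w :* u :* Db :+ u :* v :* Dg))
           refl u v w P (α ^ m) (β ^ m) (γ ^ m) Dα Dβ Dγ ⟩
    P * expSum (u * u) (v * v) (w * w) α β γ m + (1# + 1#) * (v * w * Dα + w * u * Dβ + u * v * Dγ)
      ≈⟨ +-congˡ (*-congˡ (alternating-expSum m (v * w) (w * u) (u * v) α β γ)) ⟨
    P * expSum (u * u) (v * v) (w * w) α β γ m
      + (1# + 1#) * sumTo m (λ k → binom m k * (- 1#) ^ k * expSum (v * w) (w * u) (u * v) α β γ k)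
      ∎
    where
    E : ℕ → Carrier
    E = expSum u v w α β γ
    P Dα Dβ Dγ : Carrier
    P  = (1# + 1#) ^ m
    Dα = (1# - α) ^ m
    Dβ = (1# - β) ^ m
    Dγ = (1# - γ) ^ m
    complement : ∀ {x y z} → x + y + z ≈ 1# → x + y ≈ 1# - z
    complement {x} {y} {z} x+y+z≈1 = trans (solve 3 (λ x y z → x :+ y := x :+ y :+ z :- z) refl x y z) (+-congʳ x+y+z≈1)
    αβ : α + β ≈ 1# - γ
    αβ = complement α+β+γ≈1
    αγ : α + γ ≈ 1# - β
    αγ = complement (trans (solve 3 (λ a b g → a :+ g :+ b := a :+ b :+ g) refl α β γ) α+β+γ≈1)
    βγ : β + γ ≈ 1# - α
    βγ = complement (trans (solve 3 (λ a b g → b :+ g :+ a := a :+ b :+ g) refl α β γ) α+β+γ≈1)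
    double : ∀ x → (x + x) ^ m ≈ P * x ^ m
    double x = trans (^-congˡ m (solve 1 (λ x → x :+ x := (con (ℤ.+ 1) :+ con (ℤ.+ 1)) :* x) refl x)) (^-distrib-* m _ x)

theorem7 : ∀ {c ℓ : Level} (F : Field c ℓ) →
    let open Field F hiding (zero)
        open FieldOps F
    in (α β γ : Carrier) →
       ¬ (α ≈ β) → ¬ (β ≈ γ) → ¬ (α ≈ γ) →
       cubic α ≈ 0# → cubic β ≈ 0# → cubic γ ≈ 0# →
       let open Setup F α β γ
       in (m n : ℕ) → 1 ≤ n →
          (A₁ s₁₀ s₁₁ s₁₂ : Carrier) → IsNorm₁ n A₁ s₁₀ s₁₁ s₁₂ →
          (A₁' s₁₀' s₁₁' s₁₂' : Carrier) → IsNorm₁ (2 *ℕ n) A₁' s₁₀' s₁₁' s₁₂' →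
          (A₂ s₂₀ s₂₁ s₂₂ : Carrier) → IsNorm₂ n A₂ s₂₀ s₂₁ s₂₂ →
          ((A₁ * A₁) ⁻¹) * sumTo m (λ k → binom m k * T s₁₀ s₁₁ s₁₂ k * T s₁₀ s₁₁ s₁₂ (m ∸ k))
            ≈ ((1# + 1#) ^ m) * (A₁' ⁻¹) * T s₁₀' s₁₁' s₁₂' m
              + (1# + 1#) * (A₂ ⁻¹) * sumTo m (λ k → binom m k * ((- 1#) ^ k) * T s₂₀ s₂₁ s₂₂ k)
theorem7 F α β γ α≉β β≉γ α≉γ cubic-α cubic-β cubic-γ m n _
         A₁ s₁₀ s₁₁ s₁₂ (A₁≉0 , egf≈T₁) A₁' s₁₀' s₁₁' s₁₂' (_ , egf≈T₁') A₂ s₂₀ s₂₁ s₂₂ (_ , egf≈T₂) = begin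
  (A₁ * A₁) ⁻¹ * (T s₁₀ s₁₁ s₁₂ ⋆ T s₁₀ s₁₁ s₁₂) m
    ≈⟨ inverse-square-⋆ A₁≉0 egf≈T₁ m ⟩
  (egf₁ n ⋆ egf₁ n) m
    ≈⟨ expSum-⋆-self (cubic-roots-sum α≉β β≉γ α≉γ cubic-α cubic-β cubic-γ) (c₁ ^ n) (c₂ ^ n) (c₃ ^ n) m ⟩
  (1# + 1#) ^ m * expSum (c₁ ^ n * c₁ ^ n) (c₂ ^ n * c₂ ^ n) (c₃ ^ n * c₃ ^ n) α β γ m
    + (1# + 1#) * sumTo m (λ k → binom m k * (- 1#) ^ k * expSum (c₂ ^ n * c₃ ^ n) (c₃ ^ n * c₁ ^ n) (c₁ ^ n * c₂ ^ n) α β γ k)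
    ≈⟨ +-cong (*-congˡ (expSum-cong α β γ m (^[2*n]≈^n*^n n c₁) (^[2*n]≈^n*^n n c₂) (^[2*n]≈^n*^n n c₃)))
              (*-congˡ (sumTo-cong m (λ k _ → *-congˡ
                (expSum-cong α β γ k (^-distrib-* n c₂ c₃) (^-distrib-* n c₃ c₁) (^-distrib-* n c₁ c₂))))) ⟨
  (1# + 1#) ^ m * egf₁ (2 *ℕ n) m + (1# + 1#) * sumTo m (λ k → binom m k * (- 1#) ^ k * egf₂ n k)
    ≈⟨ +-cong (trans (*-assoc _ _ _) (*-congˡ (sym (egf≈T₁' m))))
              (trans (*-assoc _ _ _) (*-congˡ (inverse-*-sumTo (λ k → binom m k * (- 1#) ^ k) egf≈T₂ m))) ⟨
  (1# + 1#) ^ m * A₁' ⁻¹ * T s₁₀' s₁₁' s₁₂' m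
    + (1# + 1#) * A₂ ⁻¹ * sumTo m (λ k → binom m k * (- 1#) ^ k * T s₂₀ s₂₁ s₂₂ k)
    ∎
  where
  open Field F hiding (zero)
  open FieldOps F
  open Setup F α β γ
  open BinomialConvolution F
  open import Relation.Binary.Reasoning.Setoid setoid
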